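{- Let $q \in \mathbb{Z}_{\mathbb{D}}$ and let $\mathfrak{N}_h=\{\nu\in\mathbb{Z}_{\mathbb{D}}:\ 0\le \nu\le |q|-1\}$. Then $(q,\mathfrak{N}_h)$ is a number system for $\mathbb{Z}_{\mathbb{D}}$ if and only if $q\le -2$.
   Context: The hyperbolic numbers are $\mathbb{D}=\{x+\mathbf{j}y: x,y\in\mathbb{R}\}$ with $\mathbf{j}\notin\mathbb{R}$, $\mathbf{j}^2=1$. Put $\mathbf{e}_1=\frac{1+\mathbf{j}}{2}$, $\mathbf{e}_2=\frac{1-\mathbf{j}}{2}$; every $z\in\mathbb{D}$ is uniquely $z=\pi_1(z)\mathbf{e}_1+\pi_2(z)\mathbf{e}_2$ with $\pi_1(x+\mathbf{j}y)=x+y$, $\pi_2(x+\mathbf{j}y)=x-y$, and algebraic operations are coordinatewise in these coordinates. $\mathbb{D}$ is partially ordered by $z\le w$ iff $\pi_k(z)\le\pi_k(w)$ for $k=1,2$ (real numbers $c$ are identified with $c\mathbf{e}_1+c\mathbf{e}_2$, so e.g. $q\le -2$ means $\pi_1(q)\le -2$ and $\pi_2(q)\le -2$). The absolute value is $|z|=|\pi_1(z)|\mathbf{e}_1+|\pi_2(z)|\mathbf{e}_2$. The hyperbolic integers are $\mathbb{Z}_{\mathbb{D}}=\mathbb{Z}\mathbf{e}_1+\mathbb{Z}\mathbf{e}_2$. For a commutative ring $R$, $q\in R$ and $\mathfrak{N}\subset R$, the pair $(q,\mathfrak{N})$ is a number system for $R$ if $\mathfrak{N}$ is a complete residue system modulo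 $q$ in $R$ (every $\alpha\in R$ is congruent modulo $q$, i.e. $q\mid \alpha-r$ in $R$, to exactly one $r\in\mathfrak{N}$) and every $\alpha\in R$ can be written as $\alpha=r_0+r_1q+\cdots+r_kq^k$ with $k\ge 0$ and $r_i\in\mathfrak{N}$. -}

module Defs where

open import Data.Integer as ℤ using (ℤ; +_; -[1+_])
open import Data.Product using (Σ; ∃; _×_; _,_)
open import Data.List using (List; []; _∷_)
open import Data.List.Relation.Unary.All using (All)
open import Relation.Binary.PropositionalEquality using (_≡_)

-- Hyperbolic integers ℤ_𝔻 = ℤ e₁ + ℤ e₂, represented by their idempotent
-- coordinates (π₁ z, π₂ z); all operations are coordinatewise in these coordinates.
record ℤD : Set where
  constructor _e₁+_e₂
  field
    π₁ : ℤ
    π₂ : ℤ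
open ℤD public

ι : ℤ → ℤD
ι c = c e₁+ c e₂

0D 1D : ℤD
0D = ι (+ 0)
1D = ι (+ 1)

infixl 6 _+D_ _-D_
infixl 7 _*D_
infix 4 _≤D_ _∣D_

_+D_ : ℤD → ℤD → ℤD
(a e₁+ b e₂) +D (c e₁+ d e₂) = (a ℤ.+ c) e₁+ (b ℤ.+ d) e₂

_*D_ : ℤD → ℤD → ℤD
(a e₁+ b e₂) *D (c e₁+ d e₂) = (a ℤ.* c) e₁+ (b ℤ.* d) e₂

-D_ : ℤD → ℤD
-D (a e₁+ b e₂) = (ℤ.- a) e₁+ (ℤ.- b) e₂

_-D_ : ℤD → ℤD → ℤD
z -D w = z +D (-D w)

∣_∣D : ℤD → ℤD
∣ a e₁+ b e₂ ∣D = (+ ℤ.∣ a ∣) e₁+ (+ ℤ.∣ b ∣) e₂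

_≤D_ : ℤD → ℤD → Set
z ≤D w = (π₁ z ℤ.≤ π₁ w) × (π₂ z ℤ.≤ π₂ w)

_∣D_ : ℤD → ℤD → Set
q ∣D a = ∃ λ c → a ≡ q *D c

_≡_[modD_] : ℤD → ℤD → ℤD → Set
a ≡ b [modD q ] = q ∣D (a -D b)

horner : ℤD → List ℤD → ℤD
horner q [] = 0D
horner q (r ∷ rs) = r +D q *D horner q rs

CompleteResidueSystem : ℤD → (ℤD → Set) → Set
CompleteResidueSystem q 𝔑 =
  (∀ α → ∃ λ r → 𝔑 r × α ≡ r [modD q ]) ×
  (∀ α r r' → 𝔑 r → 𝔑 r' → α ≡ r [modD q ] → α ≡ r' [modD q ] → r ≡ r')

-- (q, 𝔑) is a number system for ℤ_𝔻: complete residue system, and every α is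
-- α = r₀ + r₁ q + … + r_k q^k with k ≥ 0 and all r_i ∈ 𝔑
-- (written as r₀ + q · horner q (r₁ ∷ … ∷ r_k ∷ [])).
NumberSystem : ℤD → (ℤD → Set) → Set
NumberSystem q 𝔑 =
  CompleteResidueSystem q 𝔑 ×
  (∀ α → ∃ λ r₀ → Σ (List ℤD) λ rs →
       𝔑 r₀ × All 𝔑 rs × α ≡ r₀ +D q *D horner q rs)

𝔑h : ℤD → ℤD → Set
𝔑h q ν = (0D ≤D ν) × (ν ≤D ∣ q ∣D -D 1D)

-- Everything is coordinatewise in the idempotent basis, so it suffices to study the
-- integer bases q_k = π_k q with digits {0, …, |q_k| - 1}. If q_k ≥ 0 every expansion
-- is non-negative, if q_k = -1 every expansion is 0, and if q_k = 0 there are no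
-- digits at all; so -1 has an expansion only when q_k ≤ -2. Conversely, for q_k ≤ -2
-- every integer has an expansion, reached from 0 by adding or subtracting 1 to a
-- digit string, and two digits congruent modulo q_k differ by a multiple of q_k of
-- absolute value less than |q_k|, hence coincide.
module Submission where

open import Defs
open import Data.Integer using (-[1+_])
open import Function.Bundles using (_⇔_)

open import Data.Integer as ℤ using (ℤ; +_; 0ℤ; 1ℤ; -1ℤ; _+_; _*_; -_; _-_; ∣_∣; _⊖_; +≤+; -≤-)
import Data.Integer.Properties as ℤP
open import Data.Integer.Divisibility.Signed using (_∣_; divides; ∣⇒∣ᵤ; ∣m∣n⇒∣m-n)
open import Data.Integer.Tactic.RingSolver using (solve-∀)
open import Data.Nat as ℕ using (ℕ; zero; suc; z≤n; s≤s)
import Data.Nat.Properties as ℕP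
import Data.Nat.Divisibility as ℕ
open import Data.List using (List; []; _∷_; map)
open import Data.List.Relation.Unary.All as All using (All; []; _∷_)
open import Data.List.Relation.Unary.All.Properties using (map⁺)
open import Data.Product using (Σ; ∃; ∃₂; _×_; _,_)
open import Data.Empty using (⊥-elim)
open import Relation.Nullary using (yes; no; ¬_; contradiction)
open import Relation.Binary.PropositionalEquality
open import Function.Bundles using (mk⇔)

m∣n∧n<m⇒n≡0 : ∀ {m n} → m ℕ.∣ n → n ℕ.< m → n ≡ 0
m∣n∧n<m⇒n≡0 {n = zero}  _   _   = refl
m∣n∧n<m⇒n≡0 {n = suc _} m∣n n<m = contradiction m∣n (ℕ.>⇒∤ n<m)

hornerℤ : ℤ → List ℤ → ℤ
hornerℤ q []       = 0ℤ
hornerℤ q (r ∷ rs) = r + q * hornerℤ q rs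

0+q*0≡0 : ∀ q → 0ℤ + q * 0ℤ ≡ 0ℤ
0+q*0≡0 q = trans (ℤP.+-identityˡ (q * 0ℤ)) (ℤP.*-zeroʳ q)

record Digit (q x : ℤ) : Set where
  constructor digit
  field
    nonNeg : 0ℤ ℤ.≤ x
    ≤∣q∣-1 : x ℤ.≤ + ∣ q ∣ + -1ℤ

HasExpansion : ℤ → ℤ → Set
HasExpansion q α = ∃₂ λ r rs → Digit q r × All (Digit q) rs × α ≡ hornerℤ q (r ∷ rs)

¬Digit-0 : ∀ {x} → ¬ Digit 0ℤ x
¬Digit-0 (digit 0≤x x≤-1) = contradiction (ℤP.≤-trans 0≤x x≤-1) λ ()

Digit⇒Digit-0 : ∀ {q x} → Digit q x → Digit q 0ℤ
Digit⇒Digit-0 (digit 0≤x x≤∣q∣-1) = digit ℤP.≤-refl (ℤP.≤-trans 0≤x x≤∣q∣-1)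

Digit⇒<∣q∣ : ∀ {q a} → Digit q (+ a) → a ℕ.< ∣ q ∣
Digit⇒<∣q∣ {q} (digit _ a≤∣q∣-1) =
  ℤP.drop‿+<+ (ℤP.i≤pred[j]⇒i<j (subst (_ ℤ.≤_) (ℤP.+-comm (+ ∣ q ∣) -1ℤ) a≤∣q∣-1))

hornerℤ-nonNeg : ∀ {q ds} → 0ℤ ℤ.≤ q → All (Digit q) ds → 0ℤ ℤ.≤ hornerℤ q ds
hornerℤ-nonNeg _ [] = ℤP.≤-refl
hornerℤ-nonNeg {+ m} 0≤q (digit 0≤d _ ∷ ds) = ℤP.+-mono-≤ 0≤d (0≤+m* (hornerℤ-nonNeg 0≤q ds))
  where
  0≤+m* : ∀ {h} → 0ℤ ℤ.≤ h → 0ℤ ℤ.≤ + m * h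
  0≤+m* (+≤+ {n = k} _) = subst (0ℤ ℤ.≤_) (ℤP.pos-* m k) (+≤+ z≤n)

hornerℤ-[-1]≡0 : ∀ {ds} → All (Digit -1ℤ) ds → hornerℤ -1ℤ ds ≡ 0ℤ
hornerℤ-[-1]≡0 [] = refl
hornerℤ-[-1]≡0 (digit (+≤+ z≤n) (+≤+ z≤n) ∷ ds) rewrite hornerℤ-[-1]≡0 ds = refl

expansion-of-[-1]⇒≤-2 : ∀ {q} → HasExpansion q -1ℤ → q ℤ.≤ -[1+ 1 ]
expansion-of-[-1]⇒≤-2 {+ zero} (_ , _ , r , _) = ⊥-elim (¬Digit-0 r)
expansion-of-[-1]⇒≤-2 {+ suc m} (_ , _ , r , rs , -1≡) =
  contradiction (subst (0ℤ ℤ.≤_) (sym -1≡) (hornerℤ-nonNeg (+≤+ z≤n) (r ∷ rs))) λ ()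
expansion-of-[-1]⇒≤-2 { -[1+ zero ]} (_ , _ , r , rs , -1≡)
  with () ← trans -1≡ (hornerℤ-[-1]≡0 (r ∷ rs))
expansion-of-[-1]⇒≤-2 { -[1+ suc n ]} _ = -≤- (s≤s z≤n)

digit-unique : ∀ {q x y} → Digit q x → Digit q y → q ∣ x - y → x ≡ y
digit-unique {q} {+ a} {+ b} a∈ b∈ q∣a-b =
  ℤP.i-j≡0⇒i≡j (+ a) (+ b) (ℤP.∣i∣≡0⇒i≡0 (m∣n∧n<m⇒n≡0 (∣⇒∣ᵤ q∣a-b) ∣a-b∣<∣q∣))
  where
  open ℕP.≤-Reasoning
  ∣a-b∣<∣q∣ : ∣ + a - + b ∣ ℕ.< ∣ q ∣
  ∣a-b∣<∣q∣ = begin-strict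
    ∣ + a - + b ∣ ≡⟨ cong ∣_∣ (ℤP.m-n≡m⊖n a b) ⟩
    ∣ a ⊖ b ∣     ≤⟨ ℤP.∣m⊝n∣≤m⊔n a b ⟩
    a ℕ.⊔ b       <⟨ ℕP.⊔-lub (Digit⇒<∣q∣ a∈) (Digit⇒<∣q∣ b∈) ⟩
    ∣ q ∣         ∎

residue-unique : ∀ {q α x y} → Digit q x → Digit q y → q ∣ α - x → q ∣ α - y → x ≡ y
residue-unique {α = α} {x} {y} x∈ y∈ q∣α-x q∣α-y =
  digit-unique x∈ y∈ (subst (_ ∣_) (difference α x y) (∣m∣n⇒∣m-n q∣α-y q∣α-x))
  where
  difference : ∀ α x y → (α - y) - (α - x) ≡ x - y
  difference = solve-∀

module NegativeBase (n : ℕ) where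

  open ≡-Reasoning

  Q : ℤ
  Q = -[1+ suc n ]

  ⟦_⟧ : List ℕ → ℤ
  ⟦ ds ⟧ = hornerℤ Q (map +_ ds)

  -- Since Q = -(n + 2), adding 1 to the top digit n + 1 carries -1 into the next
  -- place, and subtracting 1 from the digit 0 borrows +1 from it.
  mutual
    increment : List ℕ → List ℕ
    increment []       = 1 ∷ []
    increment (d ∷ ds) with d ℕ.≟ suc n
    ... | yes _ = 0 ∷ decrement ds
    ... | no  _ = suc d ∷ ds

    decrement : List ℕ → List ℕ
    decrement []           = suc n ∷ increment []
    decrement (zero ∷ ds)  = suc n ∷ increment ds
    decrement (suc d ∷ ds) = d ∷ ds

  carry : ∀ m h → 0ℤ + - (1ℤ + m) * (-1ℤ + h) ≡ 1ℤ + (m + - (1ℤ + m) * h)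
  carry = solve-∀

  borrow : ∀ m h → m + - (1ℤ + m) * (1ℤ + h) ≡ -1ℤ + (0ℤ + - (1ℤ + m) * h)
  borrow = solve-∀

  mutual
    ⟦increment⟧ : ∀ ds → ⟦ increment ds ⟧ ≡ 1ℤ + ⟦ ds ⟧
    ⟦increment⟧ [] = cong (_+_ 1ℤ) (ℤP.*-zeroʳ Q)
    ⟦increment⟧ (d ∷ ds) with d ℕ.≟ suc n
    ... | yes refl = begin
      0ℤ + Q * ⟦ decrement ds ⟧     ≡⟨ cong (λ h → 0ℤ + Q * h) (⟦decrement⟧ ds) ⟩
      0ℤ + Q * (-1ℤ + ⟦ ds ⟧)       ≡⟨ carry (+ suc n) ⟦ ds ⟧ ⟩
      1ℤ + (+ suc n + Q * ⟦ ds ⟧)   ∎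
    ... | no _ = ℤP.+-assoc 1ℤ (+ d) (Q * ⟦ ds ⟧)

    ⟦decrement⟧ : ∀ ds → ⟦ decrement ds ⟧ ≡ -1ℤ + ⟦ ds ⟧
    ⟦decrement⟧ [] = trans (⟦suc-n∷increment⟧ []) (cong (_+_ -1ℤ) (0+q*0≡0 Q))
    ⟦decrement⟧ (zero ∷ ds) = ⟦suc-n∷increment⟧ ds
    ⟦decrement⟧ (suc d ∷ ds) = ℤP.+-assoc -1ℤ (+ suc d) (Q * ⟦ ds ⟧)

    ⟦suc-n∷increment⟧ : ∀ ds → ⟦ suc n ∷ increment ds ⟧ ≡ -1ℤ + ⟦ 0 ∷ ds ⟧
    ⟦suc-n∷increment⟧ ds = begin
      + suc n + Q * ⟦ increment ds ⟧ ≡⟨ cong (λ h → + suc n + Q * h) (⟦increment⟧ ds) ⟩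
      + suc n + Q * (1ℤ + ⟦ ds ⟧)    ≡⟨ borrow (+ suc n) ⟦ ds ⟧ ⟩
      -1ℤ + (0ℤ + Q * ⟦ ds ⟧)        ∎

  Bounded : List ℕ → Set
  Bounded = All (ℕ._≤ suc n)

  mutual
    increment-bounded : ∀ {ds} → Bounded ds → Bounded (increment ds)
    increment-bounded {[]} _ = s≤s z≤n ∷ []
    increment-bounded {d ∷ ds} (d≤ ∷ ds≤) with d ℕ.≟ suc n
    ... | yes _  = z≤n ∷ decrement-bounded ds≤
    ... | no d≢ = ℕP.≤∧≢⇒< d≤ d≢ ∷ ds≤

    decrement-bounded : ∀ {ds} → Bounded ds → Bounded (decrement ds)
    decrement-bounded {[]}         _           = ℕP.≤-refl ∷ increment-bounded []
    decrement-bounded {zero ∷ ds}  (_ ∷ ds≤)   = ℕP.≤-refl ∷ increment-bounded ds≤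
    decrement-bounded {suc d ∷ ds} (d≤ ∷ ds≤)  = ℕP.<⇒≤ d≤ ∷ ds≤

  digitsOf : ℤ → List ℕ
  digitsOf (+ zero)     = []
  digitsOf (+ suc k)    = increment (digitsOf (+ k))
  digitsOf -[1+ zero ]  = decrement []
  digitsOf -[1+ suc k ] = decrement (digitsOf -[1+ k ])

  ⟦digitsOf⟧ : ∀ α → ⟦ digitsOf α ⟧ ≡ α
  ⟦digitsOf⟧ (+ zero)     = refl
  ⟦digitsOf⟧ (+ suc k)    = trans (⟦increment⟧ (digitsOf (+ k))) (cong (_+_ 1ℤ) (⟦digitsOf⟧ (+ k)))
  ⟦digitsOf⟧ -[1+ zero ]  = ⟦decrement⟧ []
  ⟦digitsOf⟧ -[1+ suc k ] = trans (⟦decrement⟧ (digitsOf -[1+ k ])) (cong (_+_ -1ℤ) (⟦digitsOf⟧ -[1+ k ]))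

  digitsOf-bounded : ∀ α → Bounded (digitsOf α)
  digitsOf-bounded (+ zero)     = []
  digitsOf-bounded (+ suc k)    = increment-bounded (digitsOf-bounded (+ k))
  digitsOf-bounded -[1+ zero ]  = decrement-bounded []
  digitsOf-bounded -[1+ suc k ] = decrement-bounded (digitsOf-bounded -[1+ k ])

  Digit-bounded : ∀ {d} → d ℕ.≤ suc n → Digit Q (+ d)
  Digit-bounded d≤ = digit (+≤+ z≤n) (+≤+ d≤)

  hasExpansion : ∀ α → HasExpansion Q α
  hasExpansion α with digitsOf α | ⟦digitsOf⟧ α | digitsOf-bounded α
  ... | []     | 0≡α | [] =
    0ℤ , [] , Digit-bounded z≤n , [] , sym (trans (0+q*0≡0 Q) 0≡α)
  ... | d ∷ ds | ⟦d∷ds⟧≡α | d≤ ∷ ds≤ =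
    + d , map +_ ds , Digit-bounded d≤ , map⁺ (All.map Digit-bounded ds≤) , sym ⟦d∷ds⟧≡α

≤-2⇒hasExpansion : ∀ {q} → q ℤ.≤ -[1+ 1 ] → ∀ α → HasExpansion q α
≤-2⇒hasExpansion { -[1+ suc n ]} _ = NegativeBase.hasExpansion n
≤-2⇒hasExpansion { -[1+ zero ]} (-≤- ())

HasExpansionD : ℤD → ℤD → Set
HasExpansionD q α =
  ∃ λ r₀ → Σ (List ℤD) λ rs → 𝔑h q r₀ × All (𝔑h q) rs × α ≡ r₀ +D q *D horner q rs

module Coordinate
  (π : ℤD → ℤ)
  (π-0 : π 0D ≡ 0ℤ)
  (π-+ : ∀ z w → π (z +D w) ≡ π z + π w)
  (π-* : ∀ z w → π (z *D w) ≡ π z * π w)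
  (π-neg : ∀ z → π (-D z) ≡ - π z)
  (π-𝔑h : ∀ {q ν} → 𝔑h q ν → Digit (π q) (π ν))
  where

  open ≡-Reasoning

  π-horner : ∀ q rs → π (horner q rs) ≡ hornerℤ (π q) (map π rs)
  π-horner q [] = π-0
  π-horner q (r ∷ rs) = begin
    π (r +D q *D horner q rs)          ≡⟨ π-+ r (q *D horner q rs) ⟩
    π r + π (q *D horner q rs)         ≡⟨ cong (_+_ (π r)) (π-* q (horner q rs)) ⟩
    π r + π q * π (horner q rs)        ≡⟨ cong (λ h → π r + π q * h) (π-horner q rs) ⟩
    π r + π q * hornerℤ (π q) (map π rs) ∎

  π-expansion : ∀ {q α} → HasExpansionD q α → HasExpansion (π q) (π α)
  π-expansion {q} {α} (r , rs , r∈ , rs∈ , α≡) =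
    π r , map π rs , π-𝔑h r∈ , map⁺ (All.map π-𝔑h rs∈) , (begin
      π α                           ≡⟨ cong π α≡ ⟩
      π (r +D q *D horner q rs)     ≡⟨ π-horner q (r ∷ rs) ⟩
      hornerℤ (π q) (π r ∷ map π rs) ∎)

  π-∣ : ∀ {q α r} → α ≡ r [modD q ] → π q ∣ π α - π r
  π-∣ {q} {α} {r} (c , α-r≡qc) = divides (π c) (begin
    π α - π r                  ≡⟨ cong (_+_ (π α)) (π-neg r) ⟨
    π α + π (-D r)             ≡⟨ π-+ α (-D r) ⟨
    π (α -D r)                 ≡⟨ cong π α-r≡qc ⟩
    π (q *D c)                 ≡⟨ π-* q c ⟩
    π q * π c                  ≡⟨ ℤP.*-comm (π q) (π c) ⟩
    π c * π q                  ∎)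

𝔑h⇒Digit₁ : ∀ {q ν} → 𝔑h q ν → Digit (π₁ q) (π₁ ν)
𝔑h⇒Digit₁ ((0≤a , _) , (a≤ , _)) = digit 0≤a a≤

𝔑h⇒Digit₂ : ∀ {q ν} → 𝔑h q ν → Digit (π₂ q) (π₂ ν)
𝔑h⇒Digit₂ ((_ , 0≤b) , (_ , b≤)) = digit 0≤b b≤

𝔑h-pair : ∀ {q a b} → Digit (π₁ q) a → Digit (π₂ q) b → 𝔑h q (a e₁+ b e₂)
𝔑h-pair (digit 0≤a a≤) (digit 0≤b b≤) = (0≤a , 0≤b) , (a≤ , b≤)

module C₁ = Coordinate π₁ refl (λ _ _ → refl) (λ _ _ → refl) (λ _ → refl) (λ {q} → 𝔑h⇒Digit₁ {q})
module C₂ = Coordinate π₂ refl (λ _ _ → refl) (λ _ _ → refl) (λ _ → refl) (λ {q} → 𝔑h⇒Digit₂ {q})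

pairDigits : List ℤ → List ℤ → List ℤD
pairDigits []       []       = []
pairDigits (a ∷ as) []       = (a e₁+ 0ℤ e₂) ∷ pairDigits as []
pairDigits []       (b ∷ bs) = (0ℤ e₁+ b e₂) ∷ pairDigits [] bs
pairDigits (a ∷ as) (b ∷ bs) = (a e₁+ b e₂) ∷ pairDigits as bs

π₁-horner-pairDigits : ∀ q as bs → π₁ (horner q (pairDigits as bs)) ≡ hornerℤ (π₁ q) as
π₁-horner-pairDigits q []       []       = refl
π₁-horner-pairDigits q (a ∷ as) []       = cong (λ h → a + π₁ q * h) (π₁-horner-pairDigits q as [])
π₁-horner-pairDigits q []       (b ∷ bs) =
  trans (cong (λ h → 0ℤ + π₁ q * h) (π₁-horner-pairDigits q [] bs)) (0+q*0≡0 (π₁ q))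
π₁-horner-pairDigits q (a ∷ as) (b ∷ bs) = cong (λ h → a + π₁ q * h) (π₁-horner-pairDigits q as bs)

π₂-horner-pairDigits : ∀ q as bs → π₂ (horner q (pairDigits as bs)) ≡ hornerℤ (π₂ q) bs
π₂-horner-pairDigits q []       []       = refl
π₂-horner-pairDigits q (a ∷ as) []       =
  trans (cong (λ h → 0ℤ + π₂ q * h) (π₂-horner-pairDigits q as [])) (0+q*0≡0 (π₂ q))
π₂-horner-pairDigits q []       (b ∷ bs) = cong (λ h → b + π₂ q * h) (π₂-horner-pairDigits q [] bs)
π₂-horner-pairDigits q (a ∷ as) (b ∷ bs) = cong (λ h → b + π₂ q * h) (π₂-horner-pairDigits q as bs)

pairDigits-𝔑h : ∀ {q as bs} → Digit (π₁ q) 0ℤ → Digit (π₂ q) 0ℤ →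
                All (Digit (π₁ q)) as → All (Digit (π₂ q)) bs → All (𝔑h q) (pairDigits as bs)
pairDigits-𝔑h z₁ z₂ []         []         = []
pairDigits-𝔑h z₁ z₂ (a ∷ as)   []         = 𝔑h-pair a z₂ ∷ pairDigits-𝔑h z₁ z₂ as []
pairDigits-𝔑h z₁ z₂ []         (b ∷ bs)   = 𝔑h-pair z₁ b ∷ pairDigits-𝔑h z₁ z₂ [] bs
pairDigits-𝔑h z₁ z₂ (a ∷ as)   (b ∷ bs)   = 𝔑h-pair a b ∷ pairDigits-𝔑h z₁ z₂ as bs

pair-expansions : ∀ {q α} → HasExpansion (π₁ q) (π₁ α) → HasExpansion (π₂ q) (π₂ α) →
                  HasExpansionD q α
pair-expansions {q} (a , as , a∈ , as∈ , α₁≡) (b , bs , b∈ , bs∈ , α₂≡) =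
  a e₁+ b e₂ , pairDigits as bs , 𝔑h-pair a∈ b∈ ,
  pairDigits-𝔑h (Digit⇒Digit-0 a∈) (Digit⇒Digit-0 b∈) as∈ bs∈ ,
  cong₂ _e₁+_e₂
    (trans α₁≡ (cong (λ h → a + π₁ q * h) (sym (π₁-horner-pairDigits q as bs))))
    (trans α₂≡ (cong (λ h → b + π₂ q * h) (sym (π₂-horner-pairDigits q as bs))))

z+w-z≡w : ∀ z w → (z +D w) -D z ≡ w
z+w-z≡w z w = cong₂ _e₁+_e₂ (i+j-i≡j (π₁ z) (π₁ w)) (i+j-i≡j (π₂ z) (π₂ w))
  where
  i+j-i≡j : ∀ i j → (i + j) - i ≡ j
  i+j-i≡j = solve-∀

expansion⇒residue : ∀ {q α} → HasExpansionD q α → ∃ λ r → 𝔑h q r × α ≡ r [modD q ]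
expansion⇒residue {q} (r , rs , r∈ , _ , α≡) =
  r , r∈ , horner q rs , trans (cong (_-D r) α≡) (z+w-z≡w r (q *D horner q rs))

residues-unique : ∀ {q} α r r' → 𝔑h q r → 𝔑h q r' →
                  α ≡ r [modD q ] → α ≡ r' [modD q ] → r ≡ r'
residues-unique {q} α r r' r∈ r'∈ α≡r α≡r' = cong₂ _e₁+_e₂
  (residue-unique {α = π₁ α} (𝔑h⇒Digit₁ {q} r∈) (𝔑h⇒Digit₁ {q} r'∈)
    (C₁.π-∣ {q} {α} {r} α≡r) (C₁.π-∣ {q} {α} {r'} α≡r'))
  (residue-unique {α = π₂ α} (𝔑h⇒Digit₂ {q} r∈) (𝔑h⇒Digit₂ {q} r'∈)
    (C₂.π-∣ {q} {α} {r} α≡r) (C₂.π-∣ {q} {α} {r'} α≡r'))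

theorem1 : (q : ℤD) → NumberSystem q (𝔑h q) ⇔ (q ≤D ι -[1+ 1 ])
theorem1 q = mk⇔ forward backward
  where
  forward : NumberSystem q (𝔑h q) → q ≤D ι -[1+ 1 ]
  forward (_ , expand) =
    expansion-of-[-1]⇒≤-2 (C₁.π-expansion (expand (ι -1ℤ))) ,
    expansion-of-[-1]⇒≤-2 (C₂.π-expansion (expand (ι -1ℤ)))

  backward : q ≤D ι -[1+ 1 ] → NumberSystem q (𝔑h q)
  backward (π₁q≤-2 , π₂q≤-2) =
    ((λ α → expansion⇒residue {q} (expand α)) , residues-unique {q}) , expand
    where
    expand : ∀ α → HasExpansionD q α
    expand α = pair-expansions (≤-2⇒hasExpansion π₁q≤-2 (π₁ α)) (≤-2⇒hasExpansion π₂q≤-2 (π₂ α))
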